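{- Let $n$ and $r$ be integers with $0\le r\le n$, and suppose $\ell_1,\dots,\ell_r$ are homogeneous linear forms over $\mathrm{GF}(2)$ in the variables $X_1,\dots,X_{n-r}$ such that $S_n^2(X_1,\dots,X_{n-r},\ell_1,\dots,\ell_r)=0$ over $\mathrm{GF}(2)$ (as a polynomial). Then $r\ge \lfloor\frac{n}{2}\rfloor$. If moreover $n\equiv 3 \pmod 4$, then $r \ge \lceil \frac{n}{2}\rceil$.
   Context: $S_n^2(X_1,\dots,X_n) = \sum_{1\le i<j\le n} X_iX_j$. -}

module Defs where

open import Data.Bool using (Bool; true; false; _∧_; _xor_; if_then_else_)
open import Data.Nat using (ℕ; zero; suc; _+_)
open import Data.Fin using (Fin; zero; suc; splitAt; _<_; _≤_; _≟_)
open import Data.Fin.Properties using (_<?_)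
open import Data.Sum using ([_,_]′)
open import Relation.Nullary.Decidable using (⌊_⌋; Dec; yes; no)
open import Relation.Binary.PropositionalEquality using (_≡_)

-- GF(2) is modelled by Bool: addition = xor, multiplication = ∧.

Σ₂ : ∀ {k} → (Fin k → Bool) → Bool
Σ₂ {zero}  f = false
Σ₂ {suc k} f = f zero xor Σ₂ (λ i → f (suc i))

LinForm : ℕ → Set
LinForm m = Fin m → Bool

var : ∀ {m} → Fin m → LinForm m
var k a = ⌊ k ≟ a ⌋

-- A (homogeneous) quadratic polynomial over GF(2) in m variables, given by
-- its coefficients: Q a b (for a ≤ b) is the coefficient of the monomial X_a X_b
-- (X_a² when a = b).  Entries with a > b are ignored.
QuadForm : ℕ → Set
QuadForm m = Fin m → Fin m → Bool

-- Product of two linear forms, as a polynomial: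
--   (Σ u_a X_a)(Σ v_b X_b) has coefficient u_a v_a at X_a², and
--   u_a v_b + u_b v_a at X_a X_b for a < b.
mulLin : ∀ {m} → LinForm m → LinForm m → QuadForm m
mulLin u v a b with a ≟ b
... | yes _ = u a ∧ v a
... | no  _ = (u a ∧ v b) xor (u b ∧ v a)

-- The polynomial S_n^2(Y_1,…,Y_n) = Σ_{i<j} Y_i Y_j for linear forms Y_i,
-- computed coefficientwise (polynomial addition is coefficientwise).
S2 : ∀ {n m} → (Fin n → LinForm m) → QuadForm m
S2 Y a b = Σ₂ (λ j → Σ₂ (λ i → ⌊ i <? j ⌋ ∧ mulLin (Y i) (Y j) a b))

IsZeroPoly : ∀ {m} → QuadForm m → Set
IsZeroPoly {m} Q = (a b : Fin m) → a ≤ b → Q a b ≡ false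

subst : ∀ {m r} → (Fin r → LinForm m) → Fin (m + r) → LinForm m
subst {m} ℓ i = [ var , ℓ ]′ (splitAt m i)

-- Let n = m + r and let c_a ∈ GF(2)^n list the coefficients of X_a in Y = (X_1,…,X_m,ℓ_1,…,ℓ_r).
-- The coefficient of X_a² in S_n^2(Y) is e₂(c_a) = S_n^2(c_a), and that of X_a X_b is the polar
-- form B(c_a,c_b) = |c_a||c_b| + c_a·c_b of e₂, where |x| = Σ x_i. As c_a = (e_a, u_a), the
-- vanishing of these coefficients says that the vectors v_a = (1 + |u_a|, u_a) ∈ GF(2)^(r+1) are
-- orthonormal, hence linearly independent, so m ≤ r + 1, i.e. ⌊n/2⌋ ≤ r.
-- If m = r + 1 they form an orthonormal basis; since each v_a has odd weight, the all-ones vector is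
-- Σ_a v_a, so every ℓ_j(1,…,1) = 1 and Y(1,…,1) is the all-ones vector. The vanishing polynomial
-- S_n^2(Y) then forces S_n^2(1,…,1) = C(n,2) mod 2 to be 0, which fails when n ≡ 3 (mod 4).

module Submission where

open import Defs
open import Data.Nat using (ℕ; _+_; _≤_; _%_; ⌊_/2⌋; ⌈_/2⌉)
open import Data.Fin using (Fin)
open import Relation.Binary.PropositionalEquality using (_≡_)
open import Data.Product using (_×_)

open import Algebra.Bundles using (CommutativeRing)
open import Data.Bool using (Bool; true; false; not; _∧_; _xor_)
open import Data.Bool.Properties
  using ( xor-∧-commutativeRing; xor-assoc; xor-comm; xor-same; xor-identityʳ; xor-inverseˡ
        ; ∧-zeroʳ; ∧-identityʳ; ∧-idem; ∧-assoc; ∧-distribˡ-xor; ∧-distribʳ-xor; ¬-not)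
import Data.Bool.Properties as Bool
open import Data.Fin using (zero; suc; splitAt; _↑ˡ_; _↑ʳ_; punchIn; punchOut; _≟_; _<_)
open import Data.Fin.Properties using (_<?_; any?; <-cmp; <⇒≢; splitAt-↑ˡ; splitAt-↑ʳ; punchIn-punchOut; suc-injective)
import Data.Fin.Properties as Fin
open import Data.Maybe using (just; nothing)
import Data.Nat as ℕ
open import Data.Nat using (suc; s<s; s≤s; s<s⁻¹; _≤?_)
open import Data.Nat.DivMod using (_/_; m≡m%n+[m/n]*n)
open import Data.Nat.Properties using (⌊n/2⌋-mono; ⌈n/2⌉-mono; n≡⌈n+n/2⌉; +-monoˡ-≤; ≤-trans; ≤-reflexive; ≰⇒>; <⇒≤)
open import Data.Product using (∃; _,_)
open import Data.Sum using (inj₁; inj₂)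
open import Data.Vec.Functional using (Vector; _∷_; zipWith; replicate)
open import Data.List using ([]) renaming (_∷_ to _∷ₗ_)
open import Function using (_∘_; _⇔_; mk⇔)
open import Relation.Binary using (tri<; tri≈; tri>)
open import Relation.Binary.PropositionalEquality using (refl; sym; trans; cong; cong₂; _≢_; module ≡-Reasoning)
open import Relation.Nullary using (yes; no; contradiction)
open import Relation.Nullary.Decidable using (Dec; ⌊_⌋; does-⇔; isYes≗does)
open import Tactic.RingSolver using (solve-∀; solve)
open import Tactic.RingSolver.Core.AlmostCommutativeRing using (AlmostCommutativeRing; fromCommutativeRing)

open CommutativeRing xor-∧-commutativeRing using (semiring; +-commutativeSemigroup)
open import Algebra.Properties.CommutativeSemigroup +-commutativeSemigroup using (x∙yz≈y∙xz)
open import Algebra.Properties.Semiring.Sum semiring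
  using (sum; sum-syntax; sum-cong-≗; sum-replicate-zero; ∑-distrib-+; ∑-comm; *-distribˡ-sum; *-distribʳ-sum)
open ≡-Reasoning

𝔽₂ : AlmostCommutativeRing _ _
𝔽₂ = fromCommutativeRing xor-∧-commutativeRing λ { false → just refl ; true → nothing }

xor≡false⇒≡ : ∀ {a b} → a xor b ≡ false → a ≡ b
xor≡false⇒≡ {false} b≡false = sym b≡false
xor≡false⇒≡ {true} {false} ()
xor≡false⇒≡ {true} {true} _ = refl

⌊⌋-⇔ : ∀ {a b} {A : Set a} {B : Set b} → A ⇔ B → (a? : Dec A) (b? : Dec B) → ⌊ a? ⌋ ≡ ⌊ b? ⌋
⌊⌋-⇔ A⇔B a? b? = trans (isYes≗does a?) (trans (does-⇔ A⇔B a? b?) (sym (isYes≗does b?)))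

≟-sym : ∀ {n} (a b : Fin n) → ⌊ a ≟ b ⌋ ≡ ⌊ b ≟ a ⌋
≟-sym a b = ⌊⌋-⇔ (mk⇔ sym sym) (a ≟ b) (b ≟ a)

<?-suc : ∀ {n} (i j : Fin n) → ⌊ suc i <? suc j ⌋ ≡ ⌊ i <? j ⌋
<?-suc i j = ⌊⌋-⇔ (mk⇔ s<s⁻¹ s<s) (suc i <? suc j) (i <? j)

Σ₂≡sum : ∀ {k} (f : Fin k → Bool) → Σ₂ f ≡ sum f
Σ₂≡sum {ℕ.zero} f = refl
Σ₂≡sum {suc k} f = cong (f zero xor_) (Σ₂≡sum (f ∘ suc))

sum-zero : ∀ {k} {f : Fin k → Bool} → (∀ i → f i ≡ false) → sum f ≡ false
sum-zero {k} f≗false = trans (sum-cong-≗ f≗false) (sum-replicate-zero k)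

sum-δ : ∀ {n} (f : Fin n → Bool) (a : Fin n) → ∑[ k < n ] (f k ∧ ⌊ k ≟ a ⌋) ≡ f a
sum-δ f zero =
  trans (cong₂ _xor_ (∧-identityʳ (f zero)) (sum-zero λ k → ∧-zeroʳ (f (suc k)))) (xor-identityʳ (f zero))
sum-δ f (suc a) = cong₂ _xor_ (∧-zeroʳ (f zero)) (trans (sum-cong-≗ λ k → cong (f (suc k) ∧_) (δ-suc k)) (sum-δ (f ∘ suc) a))
  where
  δ-suc : ∀ k → ⌊ suc k ≟ suc a ⌋ ≡ ⌊ k ≟ a ⌋
  δ-suc k = ⌊⌋-⇔ (mk⇔ suc-injective (cong suc)) (suc k ≟ suc a) (k ≟ a)

sum-↑ : ∀ m {r} (f : Fin (m + r) → Bool) → sum f ≡ ∑[ k < m ] f (k ↑ˡ r) xor ∑[ j < r ] f (m ↑ʳ j)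
sum-↑ ℕ.zero f = refl
sum-↑ (suc m) f = trans (cong (f zero xor_) (sum-↑ m (f ∘ suc))) (sym (xor-assoc (f zero) _ _))

infixl 6 _⊕_
infix 7 _·_

_⊕_ : ∀ {n} → Vector Bool n → Vector Bool n → Vector Bool n
_⊕_ = zipWith _xor_

_·_ : ∀ {n} → Vector Bool n → Vector Bool n → Bool
_·_ {n} x y = ∑[ i < n ] (x i ∧ y i)

∑ᵛ : ∀ {k n} → (Fin k → Vector Bool n) → Vector Bool n
∑ᵛ {k} c i = ∑[ a < k ] c a i

lincomb : ∀ {p q} → (Fin p → Bool) → (Fin p → Vector Bool q) → Vector Bool q
lincomb x v = ∑ᵛ λ b i → x b ∧ v b i

·-⊕ˡ : ∀ {n} (x y t : Vector Bool n) → (x ⊕ y) · t ≡ (x · t) xor (y · t)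
·-⊕ˡ x y t = trans (sum-cong-≗ λ i → ∧-distribʳ-xor (t i) (x i) (y i)) (∑-distrib-+ (λ i → x i ∧ t i) (λ i → y i ∧ t i))

·-zeroˡ : ∀ {n} {x : Vector Bool n} (t : Vector Bool n) → (∀ i → x i ≡ false) → x · t ≡ false
·-zeroˡ t x≗false = sum-zero λ i → cong (_∧ t i) (x≗false i)

·-lincombˡ : ∀ {p q} (x : Fin p → Bool) (v : Fin p → Vector Bool q) (t : Vector Bool q) →
             lincomb x v · t ≡ ∑[ b < p ] (x b ∧ v b · t)
·-lincombˡ {p} {q} x v t = begin
  ∑[ i < q ] (∑[ b < p ] (x b ∧ v b i) ∧ t i)    ≡⟨ sum-cong-≗ (λ i → *-distribʳ-sum (t i) (λ b → x b ∧ v b i)) ⟩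
  ∑[ i < q ] ∑[ b < p ] ((x b ∧ v b i) ∧ t i)    ≡⟨ ∑-comm (λ i b → (x b ∧ v b i) ∧ t i) ⟩
  ∑[ b < p ] ∑[ i < q ] ((x b ∧ v b i) ∧ t i)    ≡⟨ sum-cong-≗ (λ b → sum-cong-≗ λ i → ∧-assoc (x b) (v b i) (t i)) ⟩
  ∑[ b < p ] ∑[ i < q ] (x b ∧ (v b i ∧ t i))    ≡⟨ sum-cong-≗ (λ b → *-distribˡ-sum (x b) (λ i → v b i ∧ t i)) ⟨
  ∑[ b < p ] (x b ∧ v b · t)                     ∎

lincomb-shear : ∀ {p q} (x : Fin p → Bool) (v : Fin p → Vector Bool q) (t : Fin p → Bool) (z : Vector Bool q) i →
                lincomb x (λ b k → v b k xor (t b ∧ z k)) i ≡ lincomb x v i xor (∑[ b < p ] (x b ∧ t b) ∧ z i)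
lincomb-shear x v t z i = begin
  ∑ᵛ (λ b k → x b ∧ (v b k xor (t b ∧ z k))) i
    ≡⟨ sum-cong-≗ (λ b → distrib (x b) (v b i) (t b) (z i)) ⟩
  ∑ᵛ (λ b k → (x b ∧ v b k) xor ((x b ∧ t b) ∧ z k)) i
    ≡⟨ ∑-distrib-+ (λ b → x b ∧ v b i) (λ b → (x b ∧ t b) ∧ z i) ⟩
  lincomb x v i xor ∑ᵛ (λ b k → (x b ∧ t b) ∧ z k) i
    ≡⟨ cong (lincomb x v i xor_) (*-distribʳ-sum (z i) (λ b → x b ∧ t b)) ⟨
  lincomb x v i xor (∑[ b < _ ] (x b ∧ t b) ∧ z i)    ∎
  where
  distrib : ∀ a b c d → a ∧ (b xor (c ∧ d)) ≡ (a ∧ b) xor ((a ∧ c) ∧ d)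
  distrib = solve-∀ 𝔽₂

-- One step of Gaussian elimination: when v₀ has a 1 at i₀, this clears coordinate i₀ of v₁ … v_p.
shear : ∀ {p q} → (Fin (suc p) → Vector Bool q) → Fin q → Fin p → Vector Bool q
shear v i₀ b k = v (suc b) k xor (v (suc b) i₀ ∧ v zero k)

linearlyDependent : ∀ {p q} → q ℕ.< p → (v : Fin p → Vector Bool q) →
                    ∃ λ x → (∃ λ a → x a ≡ true) × (∀ i → lincomb x v i ≡ false)
linearlyDependent {suc p} {ℕ.zero} _ v = (λ _ → true) , (zero , refl) , λ ()
linearlyDependent {suc p} {suc q} (s≤s q<p) v with any? (λ i → v zero i Bool.≟ true)
... | no v₀≢0 = (true ∷ λ _ → false) , (zero , refl) , λ i → cong₂ _xor_ (¬-not (v₀≢0 ∘ (i ,_))) (sum-replicate-zero p)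
... | yes (i₀ , pivot) with linearlyDependent q<p (λ b → shear v i₀ b ∘ punchIn i₀)
...   | x , (a , xa≡true) , x≗0 = (c ∷ x) , (suc a , xa≡true) , vanishes
  where
  c : Bool
  c = lincomb x (v ∘ suc) i₀

  shear-pivot : ∀ b → shear v i₀ b i₀ ≡ false
  shear-pivot b = begin
    v (suc b) i₀ xor (v (suc b) i₀ ∧ v zero i₀)   ≡⟨ cong (λ z → v (suc b) i₀ xor (v (suc b) i₀ ∧ z)) pivot ⟩
    v (suc b) i₀ xor (v (suc b) i₀ ∧ true)        ≡⟨ cong (v (suc b) i₀ xor_) (∧-identityʳ _) ⟩
    v (suc b) i₀ xor v (suc b) i₀                 ≡⟨ xor-same (v (suc b) i₀) ⟩
    false                                         ∎

  sheared-vanishes : ∀ i → lincomb x (shear v i₀) i ≡ false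
  sheared-vanishes i with i₀ ≟ i
  ... | yes refl = sum-zero λ b → trans (cong (x b ∧_) (shear-pivot b)) (∧-zeroʳ (x b))
  ... | no i₀≢i = trans (cong (lincomb x (shear v i₀)) (sym (punchIn-punchOut i₀≢i))) (x≗0 (punchOut i₀≢i))

  vanishes : ∀ i → lincomb (c ∷ x) v i ≡ false
  vanishes i = begin
    (c ∧ v zero i) xor lincomb x (v ∘ suc) i     ≡⟨ xor-comm (c ∧ v zero i) _ ⟩
    lincomb x (v ∘ suc) i xor (c ∧ v zero i)     ≡⟨ lincomb-shear x (v ∘ suc) (λ b → v (suc b) i₀) (v zero) i ⟨
    lincomb x (shear v i₀) i                     ≡⟨ sheared-vanishes i ⟩
    false                                        ∎

Orthonormal : ∀ {p q} → (Fin p → Vector Bool q) → Set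
Orthonormal v = ∀ a b → v a · v b ≡ ⌊ a ≟ b ⌋

module _ {p q} (v : Fin p → Vector Bool q) (orthonormal : Orthonormal v) where

  sum-orthonormal : ∀ (x : Fin p → Bool) a → ∑[ b < p ] (x b ∧ v b · v a) ≡ x a
  sum-orthonormal x a = trans (sum-cong-≗ λ b → cong (x b ∧_) (orthonormal b a)) (sum-δ x a)

  lincomb-·-orthonormal : ∀ (x : Fin p → Bool) a → lincomb x v · v a ≡ x a
  lincomb-·-orthonormal x a = trans (·-lincombˡ x v (v a)) (sum-orthonormal x a)

  orthonormal⇒≤ : p ℕ.≤ q
  orthonormal⇒≤ with p ≤? q
  ... | yes p≤q = p≤q
  ... | no p≰q with linearlyDependent (≰⇒> p≰q) v
  ...   | x , (a , xa≡true) , x≗0 = contradiction (trans (sym xa≡true) xa≡false) λ ()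
    where
    xa≡false : x a ≡ false
    xa≡false = trans (sym (lincomb-·-orthonormal x a)) (·-zeroˡ (v a) x≗0)

  orthogonal⇒zero : q ℕ.≤ p → ∀ {w} → (∀ a → w · v a ≡ false) → ∀ i → w i ≡ false
  orthogonal⇒zero q≤p {w} w⊥v with linearlyDependent (s≤s q≤p) (w ∷ v)
  ... | x , (a₀ , xa₀≡true) , x≗0 = w≗0
    where
    x-suc≡false : ∀ a → x (suc a) ≡ false
    x-suc≡false a = begin
      x (suc a)                                                  ≡⟨ sum-orthonormal (x ∘ suc) a ⟨
      ∑[ b < p ] (x (suc b) ∧ v b · v a)                         ≡⟨ cong (_xor ∑[ b < p ] (x (suc b) ∧ v b · v a)) (∧-zeroʳ (x zero)) ⟨
      (x zero ∧ false) xor ∑[ b < p ] (x (suc b) ∧ v b · v a)     ≡⟨ cong (λ d → (x zero ∧ d) xor ∑[ b < p ] (x (suc b) ∧ v b · v a)) (w⊥v a) ⟨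
      ∑[ b < suc p ] (x b ∧ (w ∷ v) b · v a)                     ≡⟨ ·-lincombˡ x (w ∷ v) (v a) ⟨
      lincomb x (w ∷ v) · v a                                    ≡⟨ ·-zeroˡ (v a) x≗0 ⟩
      false                                                      ∎

    x-zero≡true : x zero ≡ true
    x-zero≡true = nonzero⇒zero a₀ xa₀≡true
      where
      nonzero⇒zero : ∀ a → x a ≡ true → x zero ≡ true
      nonzero⇒zero zero    xa≡true = xa≡true
      nonzero⇒zero (suc a) xa≡true = contradiction (trans (sym xa≡true) (x-suc≡false a)) λ ()

    w≗0 : ∀ i → w i ≡ false
    w≗0 i = begin
      w i                                               ≡⟨ xor-identityʳ (w i) ⟨
      w i xor false                                     ≡⟨ cong₂ _xor_ (cong (_∧ w i) x-zero≡true) (sum-zero λ b → cong (_∧ v b i) (x-suc≡false b)) ⟨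
      lincomb x (w ∷ v) i                               ≡⟨ x≗0 i ⟩
      false                                             ∎

  orthonormal-expansion : q ℕ.≤ p → ∀ y i → y i ≡ lincomb (λ a → y · v a) v i
  orthonormal-expansion q≤p y i = xor≡false⇒≡ (orthogonal⇒zero q≤p w⊥v i)
    where
    w⊥v : ∀ a → (y ⊕ lincomb (λ a → y · v a) v) · v a ≡ false
    w⊥v a = begin
      (y ⊕ lincomb (λ a → y · v a) v) · v a                ≡⟨ ·-⊕ˡ y _ (v a) ⟩
      (y · v a) xor (lincomb (λ a → y · v a) v · v a)      ≡⟨ cong ((y · v a) xor_) (lincomb-·-orthonormal _ a) ⟩
      (y · v a) xor (y · v a)                              ≡⟨ xor-same (y · v a) ⟩
      false                                                ∎

∑< : ∀ {n} → (Fin n → Fin n → Bool) → Bool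
∑< {n} f = ∑[ j < n ] ∑[ i < n ] (⌊ i <? j ⌋ ∧ f i j)

e₂ : ∀ {n} → Vector Bool n → Bool
e₂ x = ∑< λ i j → x i ∧ x j

polar : ∀ {n} → Vector Bool n → Vector Bool n → Bool
polar x y = ∑< λ i j → (x i ∧ y j) xor (y i ∧ x j)

module _ {n : ℕ} where

  ∑<-cong : {f g : Fin n → Fin n → Bool} → (∀ i j → f i j ≡ g i j) → ∑< f ≡ ∑< g
  ∑<-cong f≗g = sum-cong-≗ λ j → sum-cong-≗ λ i → cong (⌊ i <? j ⌋ ∧_) (f≗g i j)

  ∑<-zero : {f : Fin n → Fin n → Bool} → (∀ i j → f i j ≡ false) → ∑< f ≡ false
  ∑<-zero f≗0 = sum-zero λ j → sum-zero λ i → trans (cong (⌊ i <? j ⌋ ∧_) (f≗0 i j)) (∧-zeroʳ _)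

  ∑<-xor : (f g : Fin n → Fin n → Bool) → ∑< (λ i j → f i j xor g i j) ≡ ∑< f xor ∑< g
  ∑<-xor f g = begin
    ∑[ j < n ] ∑[ i < n ] (⌊ i <? j ⌋ ∧ (f i j xor g i j))
      ≡⟨ sum-cong-≗ (λ j → sum-cong-≗ λ i → ∧-distribˡ-xor ⌊ i <? j ⌋ (f i j) (g i j)) ⟩
    ∑[ j < n ] ∑[ i < n ] ((⌊ i <? j ⌋ ∧ f i j) xor (⌊ i <? j ⌋ ∧ g i j))
      ≡⟨ sum-cong-≗ (λ j → ∑-distrib-+ (λ i → ⌊ i <? j ⌋ ∧ f i j) (λ i → ⌊ i <? j ⌋ ∧ g i j)) ⟩
    ∑[ j < n ] (∑[ i < n ] (⌊ i <? j ⌋ ∧ f i j) xor ∑[ i < n ] (⌊ i <? j ⌋ ∧ g i j))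
      ≡⟨ ∑-distrib-+ (λ j → ∑[ i < n ] (⌊ i <? j ⌋ ∧ f i j)) (λ j → ∑[ i < n ] (⌊ i <? j ⌋ ∧ g i j)) ⟩
    ∑< f xor ∑< g
      ∎

∑<-suc : ∀ {n} (f : Fin (suc n) → Fin (suc n) → Bool) →
         ∑< f ≡ ∑[ j < n ] f zero (suc j) xor ∑< (λ i j → f (suc i) (suc j))
∑<-suc {n} f = begin
  ∑< f
    ≡⟨ cong₂ _xor_ (sum-replicate-zero n) (sum-cong-≗ λ j → cong (f zero (suc j) xor_) (sum-cong-≗ λ i → cong (_∧ f (suc i) (suc j)) (<?-suc i j))) ⟩
  ∑[ j < n ] (f zero (suc j) xor ∑[ i < n ] (⌊ i <? j ⌋ ∧ f (suc i) (suc j)))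
    ≡⟨ ∑-distrib-+ (λ j → f zero (suc j)) (λ j → ∑[ i < n ] (⌊ i <? j ⌋ ∧ f (suc i) (suc j))) ⟩
  ∑[ j < n ] f zero (suc j) xor ∑< (λ i j → f (suc i) (suc j))
    ∎

e₂-⊕ : ∀ {n} (x y : Vector Bool n) → e₂ (x ⊕ y) ≡ (e₂ x xor e₂ y) xor polar x y
e₂-⊕ x y = begin
  e₂ (x ⊕ y)
    ≡⟨ ∑<-cong (λ i j → expand (x i) (y i) (x j) (y j)) ⟩
  ∑< (λ i j → ((x i ∧ x j) xor (y i ∧ y j)) xor ((x i ∧ y j) xor (y i ∧ x j)))
    ≡⟨ ∑<-xor (λ i j → (x i ∧ x j) xor (y i ∧ y j)) (λ i j → (x i ∧ y j) xor (y i ∧ x j)) ⟩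
  ∑< (λ i j → (x i ∧ x j) xor (y i ∧ y j)) xor polar x y
    ≡⟨ cong (_xor polar x y) (∑<-xor (λ i j → x i ∧ x j) (λ i j → y i ∧ y j)) ⟩
  (e₂ x xor e₂ y) xor polar x y
    ∎
  where
  expand : ∀ a b c d → (a xor b) ∧ (c xor d) ≡ ((a ∧ c) xor (b ∧ d)) xor ((a ∧ d) xor (b ∧ c))
  expand = solve-∀ 𝔽₂

e₂-cong : ∀ {n} {x y : Vector Bool n} → (∀ i → x i ≡ y i) → e₂ x ≡ e₂ y
e₂-cong x≗y = ∑<-cong λ i j → cong₂ _∧_ (x≗y i) (x≗y j)

polar-⊕ʳ : ∀ {n} (x y z : Vector Bool n) → polar x (y ⊕ z) ≡ polar x y xor polar x z
polar-⊕ʳ x y z = trans (∑<-cong λ i j → expand (x i) (y j) (z j) (y i) (z i) (x j))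
  (∑<-xor (λ i j → (x i ∧ y j) xor (y i ∧ x j)) (λ i j → (x i ∧ z j) xor (z i ∧ x j)))
  where
  expand : ∀ a b c d e f → (a ∧ (b xor c)) xor ((d xor e) ∧ f) ≡ ((a ∧ b) xor (d ∧ f)) xor ((a ∧ c) xor (e ∧ f))
  expand = solve-∀ 𝔽₂

polar-sym : ∀ {n} (x y : Vector Bool n) → polar x y ≡ polar y x
polar-sym x y = ∑<-cong λ i j → xor-comm (x i ∧ y j) (y i ∧ x j)

polar-formula : ∀ {n} (x y : Vector Bool n) → polar x y ≡ (sum x ∧ sum y) xor (x · y)
polar-formula {ℕ.zero} x y = refl
polar-formula {suc n} x y = begin
  polar x y
    ≡⟨ ∑<-suc (λ i j → (x i ∧ y j) xor (y i ∧ x j)) ⟩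
  ∑[ j < n ] ((x₀ ∧ y (suc j)) xor (y₀ ∧ x (suc j))) xor polar x′ y′
    ≡⟨ cong₂ _xor_ (∑-distrib-+ (λ j → x₀ ∧ y (suc j)) (λ j → y₀ ∧ x (suc j))) (polar-formula x′ y′) ⟩
  (∑[ j < n ] (x₀ ∧ y (suc j)) xor ∑[ j < n ] (y₀ ∧ x (suc j))) xor ((sum x′ ∧ sum y′) xor (x′ · y′))
    ≡⟨ cong (_xor ((sum x′ ∧ sum y′) xor (x′ · y′))) (cong₂ _xor_ (*-distribˡ-sum x₀ y′) (*-distribˡ-sum y₀ x′)) ⟨
  ((x₀ ∧ sum y′) xor (y₀ ∧ sum x′)) xor ((sum x′ ∧ sum y′) xor (x′ · y′))
    ≡⟨ expand x₀ y₀ (sum x′) (sum y′) (x′ · y′) ⟩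
  ((x₀ xor sum x′) ∧ (y₀ xor sum y′)) xor ((x₀ ∧ y₀) xor (x′ · y′))
    ∎
  where
  x₀ = x zero
  y₀ = y zero
  x′ = x ∘ suc
  y′ = y ∘ suc
  -- The ring solver does not know that 1 + 1 = 0, so the cancelling pair ab + ab is inserted by hand.
  expand : ∀ a b c d e → ((a ∧ d) xor (b ∧ c)) xor ((c ∧ d) xor e) ≡ ((a xor c) ∧ (b xor d)) xor ((a ∧ b) xor e)
  expand a b c d e = begin
    ((a ∧ d) xor (b ∧ c)) xor ((c ∧ d) xor e)                                   ≡⟨ cong (_xor (((a ∧ d) xor (b ∧ c)) xor ((c ∧ d) xor e))) (xor-same (a ∧ b)) ⟨
    ((a ∧ b) xor (a ∧ b)) xor (((a ∧ d) xor (b ∧ c)) xor ((c ∧ d) xor e))         ≡⟨ solve (a ∷ₗ b ∷ₗ c ∷ₗ d ∷ₗ e ∷ₗ []) 𝔽₂ ⟩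
    ((a xor c) ∧ (b xor d)) xor ((a ∧ b) xor e)                                 ∎

polar-self : ∀ {n} (x : Vector Bool n) → polar x x ≡ false
polar-self x = begin
  polar x x                        ≡⟨ polar-formula x x ⟩
  (sum x ∧ sum x) xor (x · x)      ≡⟨ cong₂ _xor_ (∧-idem (sum x)) (sum-cong-≗ λ i → ∧-idem (x i)) ⟩
  sum x xor sum x                  ≡⟨ xor-same (sum x) ⟩
  false                            ∎

TotallySingular : ∀ {k n} → (Fin k → Vector Bool n) → Set
TotallySingular c = (∀ a → e₂ (c a) ≡ false) × (∀ a b → polar (c a) (c b) ≡ false)

polar-∑ᵛʳ : ∀ {k n} (x : Vector Bool n) (c : Fin k → Vector Bool n) → (∀ a → polar x (c a) ≡ false) → polar x (∑ᵛ c) ≡ false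
polar-∑ᵛʳ {ℕ.zero} x c _ = ∑<-zero λ i j → trans (xor-identityʳ (x i ∧ false)) (∧-zeroʳ (x i))
polar-∑ᵛʳ {suc k} x c x⊥c =
  trans (polar-⊕ʳ x (c zero) (∑ᵛ (c ∘ suc))) (cong₂ _xor_ (x⊥c zero) (polar-∑ᵛʳ x (c ∘ suc) (x⊥c ∘ suc)))

e₂-∑ᵛ : ∀ {k n} (c : Fin k → Vector Bool n) → TotallySingular c → e₂ (∑ᵛ c) ≡ false
e₂-∑ᵛ {ℕ.zero} {n} c _ = ∑<-zero {n} λ i j → refl
e₂-∑ᵛ {suc k} c (e₂c≡0 , polar-c≡0) = begin
  e₂ (c zero ⊕ ∑ᵛ (c ∘ suc))                                        ≡⟨ e₂-⊕ (c zero) (∑ᵛ (c ∘ suc)) ⟩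
  (e₂ (c zero) xor e₂ (∑ᵛ (c ∘ suc))) xor polar (c zero) (∑ᵛ (c ∘ suc)) ≡⟨ cong₂ _xor_ (cong₂ _xor_ (e₂c≡0 zero) rest) cross ⟩
  false                                                             ∎
  where
  rest = e₂-∑ᵛ (c ∘ suc) (e₂c≡0 ∘ suc , λ a b → polar-c≡0 (suc a) (suc b))
  cross = polar-∑ᵛʳ (c zero) (c ∘ suc) (polar-c≡0 zero ∘ suc)

e₂-ones-+2 : ∀ n → e₂ (replicate (2 + n) true) ≡ not (e₂ (replicate n true))
e₂-ones-+2 n = begin
  e₂ (replicate (2 + n) true)           ≡⟨ ∑<-suc {suc n} (λ _ _ → true) ⟩
  not s xor e₂ (replicate (suc n) true) ≡⟨ cong (not s xor_) (∑<-suc {n} (λ _ _ → true)) ⟩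
  not s xor (s xor e)                   ≡⟨ xor-assoc (not s) s e ⟨
  (not s xor s) xor e                   ≡⟨ cong (_xor e) (xor-inverseˡ s) ⟩
  not e                                 ∎
  where
  s = sum (replicate n true)
  e = e₂ (replicate n true)

-- e₂(1,…,1) = C(n,2) mod 2, which is 1 exactly when n ≡ 2, 3 (mod 4).
e₂-ones-3mod4 : ∀ n → n % 4 ≡ 3 → e₂ (replicate n true) ≡ true
e₂-ones-3mod4 n n≡3 = trans (cong (λ k → e₂ (replicate k true)) n≡3+4k) (3+4k (n / 4))
  where
  n≡3+4k : n ≡ 3 + n / 4 ℕ.* 4
  n≡3+4k = trans (m≡m%n+[m/n]*n n 4) (cong (_+ n / 4 ℕ.* 4) n≡3)
  3+4k : ∀ k → e₂ (replicate (3 + k ℕ.* 4) true) ≡ true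
  3+4k ℕ.zero = refl
  3+4k (suc k) = begin
    e₂ (replicate (2 + (2 + (3 + k ℕ.* 4))) true)  ≡⟨ e₂-ones-+2 (2 + (3 + k ℕ.* 4)) ⟩
    not (e₂ (replicate (2 + (3 + k ℕ.* 4)) true))   ≡⟨ cong not (e₂-ones-+2 (3 + k ℕ.* 4)) ⟩
    not (not (e₂ (replicate (3 + k ℕ.* 4) true)))   ≡⟨ cong (not ∘ not) (3+4k k) ⟩
    true                                          ∎

⌊m+r/2⌋≤r : ∀ {m} r → m ≤ suc r → ⌊ (m + r) /2⌋ ≤ r
⌊m+r/2⌋≤r r m≤1+r = ≤-trans (⌊n/2⌋-mono (+-monoˡ-≤ r m≤1+r)) (≤-reflexive (sym (n≡⌈n+n/2⌉ r)))

⌈m+r/2⌉≤r : ∀ {m} r → m ≤ r → ⌈ (m + r) /2⌉ ≤ r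
⌈m+r/2⌉≤r r m≤r = ≤-trans (⌈n/2⌉-mono (+-monoˡ-≤ r m≤r)) (≤-reflexive (sym (n≡⌈n+n/2⌉ r)))

column : ∀ {n m} → (Fin n → LinForm m) → Fin m → Vector Bool n
column Y a i = Y i a

module _ {n m} (Y : Fin n → LinForm m) where

  S2≡∑< : ∀ a b → S2 Y a b ≡ ∑< (λ i j → mulLin (Y i) (Y j) a b)
  S2≡∑< a b = trans (Σ₂≡sum (λ j → Σ₂ (λ i → f i j))) (sum-cong-≗ λ j → Σ₂≡sum (λ i → f i j))
    where
    f : Fin n → Fin n → Bool
    f i j = ⌊ i <? j ⌋ ∧ mulLin (Y i) (Y j) a b

  S2-offDiagonal : ∀ {a b} → a ≢ b → S2 Y a b ≡ polar (column Y a) (column Y b)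
  S2-offDiagonal {a} {b} a≢b = trans (S2≡∑< a b) (∑<-cong mulLin-≢)
    where
    mulLin-≢ : ∀ i j → mulLin (Y i) (Y j) a b ≡ (Y i a ∧ Y j b) xor (Y i b ∧ Y j a)
    mulLin-≢ i j with a ≟ b
    ... | yes a≡b = contradiction a≡b a≢b
    ... | no _ = refl

  S2-diagonal : ∀ a → S2 Y a a ≡ e₂ (column Y a)
  S2-diagonal a = trans (S2≡∑< a a) (∑<-cong mulLin-diag)
    where
    mulLin-diag : ∀ i j → mulLin (Y i) (Y j) a a ≡ Y i a ∧ Y j a
    mulLin-diag i j with a ≟ a
    ... | yes _ = refl
    ... | no a≢a = contradiction refl a≢a

  S2≡0⇒totallySingular : IsZeroPoly (S2 Y) → TotallySingular (column Y)
  S2≡0⇒totallySingular S2≡0 = (λ a → trans (sym (S2-diagonal a)) (S2≡0 a a Fin.≤-refl)) , polar≡0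
    where
    polar-< : ∀ {a b} → a < b → polar (column Y a) (column Y b) ≡ false
    polar-< a<b = trans (sym (S2-offDiagonal (<⇒≢ a<b))) (S2≡0 _ _ (<⇒≤ a<b))
    polar≡0 : ∀ a b → polar (column Y a) (column Y b) ≡ false
    polar≡0 a b with <-cmp a b
    ... | tri< a<b _ _ = polar-< a<b
    ... | tri≈ _ refl _ = polar-self (column Y a)
    ... | tri> _ _ b<a = trans (polar-sym (column Y a) (column Y b)) (polar-< b<a)

module SubstitutedColumns {m r} (ℓ : Fin r → LinForm m) where

  col : Fin m → Vector Bool (m + r)
  col = column (subst ℓ)

  u : Fin m → Vector Bool r
  u a j = ℓ j a

  v : Fin m → Vector Bool (suc r)
  v a = not (sum (u a)) ∷ u a

  col-↑ˡ : ∀ a k → col a (k ↑ˡ r) ≡ ⌊ k ≟ a ⌋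
  col-↑ˡ a k rewrite splitAt-↑ˡ m k r = refl

  col-↑ʳ : ∀ a j → col a (m ↑ʳ j) ≡ u a j
  col-↑ʳ a j rewrite splitAt-↑ʳ m r j = refl

  sum-col : ∀ a → sum (col a) ≡ not (sum (u a))
  sum-col a = trans (sum-↑ m (col a)) (cong₂ _xor_ (trans (sum-cong-≗ (col-↑ˡ a)) (sum-δ (λ _ → true) a)) (sum-cong-≗ (col-↑ʳ a)))

  ·-col : ∀ a b → col a · col b ≡ ⌊ a ≟ b ⌋ xor (u a · u b)
  ·-col a b = trans (sum-↑ m (λ i → col a i ∧ col b i)) (cong₂ _xor_ e-part u-part)
    where
    e-part : ∑[ k < m ] (col a (k ↑ˡ r) ∧ col b (k ↑ˡ r)) ≡ ⌊ a ≟ b ⌋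
    e-part = trans (sum-cong-≗ λ k → cong₂ _∧_ (col-↑ˡ a k) (col-↑ˡ b k)) (trans (sum-δ (λ k → ⌊ k ≟ a ⌋) b) (≟-sym b a))
    u-part : ∑[ j < r ] (col a (m ↑ʳ j) ∧ col b (m ↑ʳ j)) ≡ u a · u b
    u-part = sum-cong-≗ λ j → cong₂ _∧_ (col-↑ʳ a j) (col-↑ʳ b j)

  polar-col : ∀ a b → polar (col a) (col b) ≡ ⌊ a ≟ b ⌋ xor (v a · v b)
  polar-col a b = begin
    polar (col a) (col b)                                        ≡⟨ polar-formula (col a) (col b) ⟩
    (sum (col a) ∧ sum (col b)) xor (col a · col b)              ≡⟨ cong₂ _xor_ (cong₂ _∧_ (sum-col a) (sum-col b)) (·-col a b) ⟩
    (s ∧ t) xor (δ xor (u a · u b))                              ≡⟨ x∙yz≈y∙xz (s ∧ t) δ (u a · u b) ⟩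
    δ xor ((s ∧ t) xor (u a · u b))                              ∎
    where
    s = not (sum (u a))
    t = not (sum (u b))
    δ = ⌊ a ≟ b ⌋

  totallySingular⇒orthonormal : TotallySingular col → Orthonormal v
  totallySingular⇒orthonormal (_ , polar≡0) a b = sym (xor≡false⇒≡ (trans (sym (polar-col a b)) (polar≡0 a b)))

  -- Expanding 1 in the orthonormal basis gives 1 = Σ_a (1 · v_a) v_a = Σ_a v_a, as every v_a
  -- has odd weight; the last r coordinates of this say ℓ_j(1,…,1) = 1.
  ∑ᵛ-col≡ones : Orthonormal v → r ℕ.< m → ∀ i → ∑ᵛ col i ≡ true
  ∑ᵛ-col≡ones orthonormal r<m i with splitAt m i
  ... | inj₁ k = trans (sum-cong-≗ λ a → ≟-sym k a) (sum-δ (λ _ → true) k)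
  ... | inj₂ j = sym (trans (orthonormal-expansion v orthonormal r<m (replicate (suc r) true) (suc j))
                           (sum-cong-≗ λ a → cong (_∧ ℓ j a) (xor-inverseˡ (sum (u a)))))

mainTheorem18 : (m r : ℕ) (ℓ : Fin r → LinForm m) →
    IsZeroPoly (S2 (subst ℓ)) →
    (⌊ (m + r) /2⌋ ≤ r) × ((m + r) % 4 ≡ 3 → ⌈ (m + r) /2⌉ ≤ r)
mainTheorem18 m r ℓ S2≡0 = ⌊m+r/2⌋≤r r m≤1+r , ⌈n/2⌉≤r
  where
  open SubstitutedColumns ℓ

  singular : TotallySingular col
  singular = S2≡0⇒totallySingular (subst ℓ) S2≡0

  orthonormal : Orthonormal v
  orthonormal = totallySingular⇒orthonormal singular

  m≤1+r : m ≤ suc r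
  m≤1+r = orthonormal⇒≤ v orthonormal

  ⌈n/2⌉≤r : (m + r) % 4 ≡ 3 → ⌈ (m + r) /2⌉ ≤ r
  ⌈n/2⌉≤r n≡3 with m ≤? r
  ... | yes m≤r = ⌈m+r/2⌉≤r r m≤r
  ... | no m≰r = contradiction (trans (sym (e₂-ones-3mod4 (m + r) n≡3)) e₂[1]≡0) λ ()
    where
    e₂[1]≡0 : e₂ (replicate (m + r) true) ≡ false
    e₂[1]≡0 = trans (e₂-cong λ i → sym (∑ᵛ-col≡ones orthonormal (≰⇒> m≰r) i)) (e₂-∑ᵛ col singular)
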